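{- For every $\lambda\mu$-term $M$ that is strongly normalising, there exist a restricted basis $\Gamma$, a restricted context $\Delta$ and a restricted term type $\delta$ such that $\Gamma\vdash_r M:\delta\mid\Delta$ is derivable in the restricted intersection type system defined below.
   Context: Syntax. $\lambda\mu$-terms are $M::=x\mid\lambda x.M\mid MN\mid\mu\alpha.c$ and commands are $c::=[\alpha]M$. Structural substitution is defined by $([\alpha]M)[\alpha\Leftarrow L]=[\alpha](M[\alpha\Leftarrow L])L$ and homomorphically otherwise. Reduction is the compatible closure of $(\lambda x.M)N\to M[N/x]$ and $(\mu\alpha.c)N\to\mu\alpha.c[\alpha\Leftarrow N]$. Strongly normalising means there is no infinite reduction sequence. Restricted types. With a single constant $\psi$: $\delta::=\kappa\to\psi\mid\delta\wedge\delta$ and $\kappa::=\omega\mid\delta\times\kappa\mid\kappa\wedge\kappa$. The preorders $\le^r_D,\le^r_C$ are the least preorders such that: - $\wedge$ is a meet in each sort; - $\kappa\le^r_C\omega$; - $(\delta_1\times\kappa_1)\wedge(\delta_2\times\kappa_2)\le^r_C(\delta_1\wedge\delta_2)\times(\kappa_1\wedge\kappa_2)$; - $\times$ is covariant in both arguments; - $\kappa_2\le^r_C\kappa_1\Rightarrow\kappa_1\to\psi\le^r_D\kappa_2\to\psi$. Restricted system. A restricted basis $\Gamma$ is a finite map from variables to restricted term types; a restricted context $\Delta$ is a finite map from names to restricted continuation types, with $\Delta(\alpha)=\omega$ if absent. Rules: - (Ax) $\Gamma,x{:}\delta\vdash_r x:\delta\mid\Delta$; - ($\lambda$) from $\Gamma,x{:}\delta\vdash_r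 M:\kappa\to\psi\mid\Delta$ infer $\Gamma\vdash_r\lambda x.M:(\delta\times\kappa)\to\psi\mid\Delta$; - (App) from $M:(\delta\times\kappa)\to\psi$ and $N:\delta$ infer $MN:\kappa\to\psi$; - (cmd) from $\Gamma\vdash_r M:\delta\mid\Delta$ infer $\Gamma\vdash_r[\alpha]M:\delta\times\Delta(\alpha)\mid\Delta$; - ($\mu$) from $\Gamma\vdash_r c:(\kappa'\to\psi)\times\kappa'\mid\Delta$ infer $\Gamma\vdash_r\mu\alpha.c:\Delta(\alpha)\to\psi\mid\Delta\setminus\alpha$; - ($\wedge$) and ($\le$) subsumption along $\le^r$. There is no $\omega$-rule. -}

module Defs where

open import Data.Nat using (ℕ; zero; suc; _≡ᵇ_)
open import Data.Bool using (if_then_else_)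
open import Data.List using (List; []; _∷_)
open import Data.Maybe using (Maybe; just; nothing)
open import Relation.Binary.PropositionalEquality using (_≡_)
open import Induction.WellFounded using (Acc)

-- λμ-syntax, locally nameless via de Bruijn indices.
-- Two independent index spaces: term variables (bound by lam) and
-- names / continuation variables (bound by mu).

mutual
  data Term : Set where
    var : ℕ → Term
    lam : Term → Term
    app : Term → Term → Term
    mu  : Cmd → Term

  data Cmd : Set where
    named : ℕ → Term → Cmd  -- [α]M  (α a de Bruijn name index)

extR : (ℕ → ℕ) → ℕ → ℕ
extR ρ zero    = zero
extR ρ (suc i) = suc (ρ i)

mutual
  renT : (ℕ → ℕ) → Term → Term
  renT ρ (var i)   = var (ρ i)
  renT ρ (lam M)   = lam (renT (extR ρ) M)
  renT ρ (app M N) = app (renT ρ M) (renT ρ N)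
  renT ρ (mu c)    = mu (renTC ρ c)

  renTC : (ℕ → ℕ) → Cmd → Cmd
  renTC ρ (named a M) = named a (renT ρ M)

mutual
  renN : (ℕ → ℕ) → Term → Term
  renN ρ (var i)   = var i
  renN ρ (lam M)   = lam (renN ρ M)
  renN ρ (app M N) = app (renN ρ M) (renN ρ N)
  renN ρ (mu c)    = mu (renNC (extR ρ) c)

  renNC : (ℕ → ℕ) → Cmd → Cmd
  renNC ρ (named a M) = named (ρ a) (renN ρ M)

extS : (ℕ → Term) → ℕ → Term
extS σ zero    = var zero
extS σ (suc i) = renT suc (σ i)

mutual
  subT : (ℕ → Term) → Term → Term
  subT σ (var i)   = σ i
  subT σ (lam M)   = lam (subT (extS σ) M)
  subT σ (app M N) = app (subT σ M) (subT σ N)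
  subT σ (mu c)    = mu (subTC (λ i → renN suc (σ i)) c)

  subTC : (ℕ → Term) → Cmd → Cmd
  subTC σ (named a M) = named a (subT σ M)

-- the substitution [N/0], shifting the remaining free variables down
sub0 : Term → ℕ → Term
sub0 N zero    = N
sub0 N (suc i) = var i

-- structural substitution  _[α ⇐ L]  :
--   ([α]M)[α⇐L] = [α]((M[α⇐L]) L), homomorphic otherwise
mutual
  strS : ℕ → Term → Term → Term
  strS a L (var i)   = var i
  strS a L (lam M)   = lam (strS a (renT suc L) M)
  strS a L (app M N) = app (strS a L M) (strS a L N)
  strS a L (mu c)    = mu (strSC (suc a) (renN suc L) c)

  strSC : ℕ → Term → Cmd → Cmd
  strSC a L (named b M) =
    if b ≡ᵇ a then named b (app (strS a L M) L) else named b (strS a L M)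

infix 4 _⟶_
data _⟶_ : Term → Term → Set where
  β    : ∀ {M N} → app (lam M) N ⟶ subT (sub0 N) M
  μ    : ∀ {c N} → app (mu c) N ⟶ mu (strSC zero (renN suc N) c)
  ξlam : ∀ {M M'} → M ⟶ M' → lam M ⟶ lam M'
  ξappL : ∀ {M M' N} → M ⟶ M' → app M N ⟶ app M' N
  ξappR : ∀ {M N N'} → N ⟶ N' → app M N ⟶ app M N'
  ξmu  : ∀ {a M M'} → M ⟶ M' → mu (named a M) ⟶ mu (named a M')

SN : Term → Set
SN = Acc (λ N M → M ⟶ N)

mutual
  data TyD : Set where
    _⇒ψ  : TyK → TyD
    _∧D_ : TyD → TyD → TyD

  data TyK : Set where
    ω    : TyK
    _×K_ : TyD → TyK → TyK
    _∧K_ : TyK → TyK → TyK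

-- the preorders ≤ʳ_D and ≤ʳ_C (least such: inductively generated)
mutual
  data _≤D_ : TyD → TyD → Set where
    reflD  : ∀ {d} → d ≤D d
    transD : ∀ {d₁ d₂ d₃} → d₁ ≤D d₂ → d₂ ≤D d₃ → d₁ ≤D d₃
    lb₁D   : ∀ {d₁ d₂} → (d₁ ∧D d₂) ≤D d₁
    lb₂D   : ∀ {d₁ d₂} → (d₁ ∧D d₂) ≤D d₂
    glbD   : ∀ {d d₁ d₂} → d ≤D d₁ → d ≤D d₂ → d ≤D (d₁ ∧D d₂)
    arrD   : ∀ {k₁ k₂} → k₂ ≤C k₁ → (k₁ ⇒ψ) ≤D (k₂ ⇒ψ)

  data _≤C_ : TyK → TyK → Set where
    reflC  : ∀ {k} → k ≤C k
    transC : ∀ {k₁ k₂ k₃} → k₁ ≤C k₂ → k₂ ≤C k₃ → k₁ ≤C k₃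
    lb₁C   : ∀ {k₁ k₂} → (k₁ ∧K k₂) ≤C k₁
    lb₂C   : ∀ {k₁ k₂} → (k₁ ∧K k₂) ≤C k₂
    glbC   : ∀ {k k₁ k₂} → k ≤C k₁ → k ≤C k₂ → k ≤C (k₁ ∧K k₂)
    topC   : ∀ {k} → k ≤C ω
    distC  : ∀ {d₁ d₂ k₁ k₂} →
             ((d₁ ×K k₁) ∧K (d₂ ×K k₂)) ≤C ((d₁ ∧D d₂) ×K (k₁ ∧K k₂))
    prodC  : ∀ {d₁ d₂ k₁ k₂} → d₁ ≤D d₂ → k₁ ≤C k₂ → (d₁ ×K k₁) ≤C (d₂ ×K k₂)

-- Γ : position i holds the type of term variable i, if any
Basis : Set
Basis = List (Maybe TyD)

-- Δ : position i holds the type of name i; absent entries mean ω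
Ctx : Set
Ctx = List TyK

lookupΓ : Basis → ℕ → Maybe TyD
lookupΓ []       i       = nothing
lookupΓ (x ∷ Γ)  zero    = x
lookupΓ (x ∷ Γ)  (suc i) = lookupΓ Γ i

lookupΔ : Ctx → ℕ → TyK
lookupΔ []      i       = ω
lookupΔ (k ∷ Δ) zero    = k
lookupΔ (k ∷ Δ) (suc i) = lookupΔ Δ i

-- Δ \ α for α the name bound by the μ (index 0)
dropΔ : Ctx → Ctx
dropΔ []      = []
dropΔ (k ∷ Δ) = Δ

mutual
  data _⊢ʳ_∶_∣_ : Basis → Term → TyD → Ctx → Set where
    ax   : ∀ {Γ Δ x d} → lookupΓ Γ x ≡ just d → Γ ⊢ʳ var x ∶ d ∣ Δ
    lamR : ∀ {Γ Δ M d k} →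
           (just d ∷ Γ) ⊢ʳ M ∶ (k ⇒ψ) ∣ Δ →
           Γ ⊢ʳ lam M ∶ ((d ×K k) ⇒ψ) ∣ Δ
    appR : ∀ {Γ Δ M N d k} →
           Γ ⊢ʳ M ∶ ((d ×K k) ⇒ψ) ∣ Δ → Γ ⊢ʳ N ∶ d ∣ Δ →
           Γ ⊢ʳ app M N ∶ (k ⇒ψ) ∣ Δ
    muR  : ∀ {Γ Δ c k'} →
           Γ ⊢ᶜʳ c ∶ ((k' ⇒ψ) ×K k') ∣ Δ →
           Γ ⊢ʳ mu c ∶ (lookupΔ Δ zero ⇒ψ) ∣ dropΔ Δ
    ∧R   : ∀ {Γ Δ M d₁ d₂} →
           Γ ⊢ʳ M ∶ d₁ ∣ Δ → Γ ⊢ʳ M ∶ d₂ ∣ Δ → Γ ⊢ʳ M ∶ (d₁ ∧D d₂) ∣ Δ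
    ≤R   : ∀ {Γ Δ M d d'} → Γ ⊢ʳ M ∶ d ∣ Δ → d ≤D d' → Γ ⊢ʳ M ∶ d' ∣ Δ

  data _⊢ᶜʳ_∶_∣_ : Basis → Cmd → TyK → Ctx → Set where
    cmdR  : ∀ {Γ Δ a M d} →
            Γ ⊢ʳ M ∶ d ∣ Δ → Γ ⊢ᶜʳ named a M ∶ (d ×K lookupΔ Δ a) ∣ Δ
    ∧Rᶜ   : ∀ {Γ Δ c k₁ k₂} →
            Γ ⊢ᶜʳ c ∶ k₁ ∣ Δ → Γ ⊢ᶜʳ c ∶ k₂ ∣ Δ → Γ ⊢ᶜʳ c ∶ (k₁ ∧K k₂) ∣ Δ
    ≤Rᶜ   : ∀ {Γ Δ c k k'} → Γ ⊢ᶜʳ c ∶ k ∣ Δ → k ≤C k' → Γ ⊢ᶜʳ c ∶ k' ∣ Δ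

module Submission where

-- Types are built by well-founded induction over strongly normalising terms, ordered by
-- reduction together with the subterm relation; the union is accessible from every SN term
-- because a reduction step inside a subterm is a reduction step of the whole term.  Variables,
-- abstractions, μ-abstractions and neutral applications are typed compositionally.  A term
-- with a head β- or μ-redex is typed by typing its contractum and expanding: inverting
-- (structural) substitution gives the argument the intersection of the types of its
-- copies, and an erased argument is typed by the induction hypothesis for it as a subterm.
-- The derivations live in a syntax-directed variant of ⊢ʳ and are read back at the end.

open import Defs
open import Data.Bool using (true; false; if_then_else_)
open import Data.Bool.Properties using (T-≡)
open import Data.List using ([]; _∷_)
open import Data.Maybe using (Maybe; just; nothing; fromMaybe)
open import Data.Maybe.Relation.Unary.All as All using (All; just; nothing)
open import Data.Nat using (ℕ; zero; suc; _≡ᵇ_; _<_; _≤_; _⊔_; s≤s)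
open import Data.Nat.Properties using (≡ᵇ⇒≡; m≤m⊔n; m≤n⊔m; ≤-trans; ≤-refl; n≤1+n)
open import Data.Product using (∃; ∃-syntax; _×_; _,_; proj₁; proj₂)
open import Data.Sum using (_⊎_; inj₁; inj₂)
open import Function using (_∘_; flip)
open import Function.Bundles using (Equivalence)
open import Induction.WellFounded using (Acc; acc; WellFounded; WfRec)
open import Level using (Level)
open import Relation.Binary.Core using (Rel)
open import Relation.Binary.Definitions using (Transitive)
open import Relation.Binary.Construct.Union using (_∪_)
open import Relation.Binary.Construct.Closure.Reflexive using (ReflClosure; refl; [_])
open import Relation.Binary.Construct.Closure.Transitive as Plus using (TransClosure; [_]; _∷_; _∷ʳ_)
open import Relation.Binary.PropositionalEquality using (_≡_; refl; sym; trans; cong; subst)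

-- Accessibility of a union of relations

StepsLift : ∀ {a ℓ₁ ℓ₂} {A : Set a} → Rel A ℓ₁ → Rel A ℓ₂ → Set (a Level.⊔ ℓ₁ Level.⊔ ℓ₂)
StepsLift R S = ∀ {x y z} → S y x → R z y → ∃[ w ] R w x × S z w

module _ {a ℓ₁ ℓ₂} {A : Set a} {R : Rel A ℓ₁} {S : Rel A ℓ₂} where

  StepsLift-⁺ : StepsLift R S → StepsLift R (TransClosure S)
  StepsLift-⁺ lift [ y<x ] z<y with lift y<x z<y
  ... | w , w<x , z<w = w , w<x , [ z<w ]
  StepsLift-⁺ lift (y<v ∷ v<x) z<y with lift y<v z<y
  ... | w , w<v , z<w with StepsLift-⁺ lift v<x w<v
  ... | w' , w'<x , w<w' = w' , w'<x , z<w ∷ w<w'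

  module _ (S-trans : Transitive S) (S-wf : WellFounded S) (lift : StepsLift R S) where

    private
      mutual
        acc-below : ∀ {x y} → Acc R x → Acc S y → ReflClosure S y x → Acc (R ∪ S) y
        acc-below accR accS y≤x = acc (acc-below-step accR accS y≤x)

        acc-below-step : ∀ {x y} → Acc R x → Acc S y → ReflClosure S y x →
                         WfRec (R ∪ S) (Acc (R ∪ S)) y
        acc-below-step (acc rsR) _ refl (inj₁ zRy) = acc-below (rsR zRy) (S-wf _) refl
        acc-below-step (acc rsR) _ [ ySx ] (inj₁ zRy) with lift ySx zRy
        ... | w , wRx , zSw = acc-below (rsR wRx) (S-wf _) [ zSw ]
        acc-below-step accR (acc rsS) refl (inj₂ zSy) = acc-below accR (rsS zSy) [ zSy ]
        acc-below-step accR (acc rsS) [ ySx ] (inj₂ zSy) =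
          acc-below accR (rsS zSy) [ S-trans zSy ySx ]

    Acc-∪ : ∀ {x} → Acc R x → Acc (R ∪ S) x
    Acc-∪ accR = acc-below accR (S-wf _) refl

variable
  M N : Term
  c : Cmd
  a b x : ℕ
  n n' m m' : ℕ

infix 4 _◃_ _⊏_ _≺_

data _◃_ : Term → Term → Set where
  lam-body : M ◃ lam M
  app-fun  : M ◃ app M N
  app-arg  : N ◃ app M N
  mu-body  : M ◃ mu (named a M)

_⊏_ : Term → Term → Set
_⊏_ = TransClosure _◃_

mutual
  ◃-wellFounded : WellFounded _◃_
  ◃-wellFounded M = acc (◃-below M)

  ◃-below : ∀ M → WfRec _◃_ (Acc _◃_) M
  ◃-below (lam M)           lam-body = ◃-wellFounded M
  ◃-below (app M N)         app-fun  = ◃-wellFounded M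
  ◃-below (app M N)         app-arg  = ◃-wellFounded N
  ◃-below (mu (named a M))  mu-body  = ◃-wellFounded M

◃-lift : StepsLift (flip _⟶_) _◃_
◃-lift lam-body r = _ , ξlam r , lam-body
◃-lift app-fun  r = _ , ξappL r , app-fun
◃-lift app-arg  r = _ , ξappR r , app-arg
◃-lift mu-body  r = _ , ξmu r , mu-body

_≺_ : Term → Term → Set
_≺_ = flip _⟶_ ∪ _⊏_

SN⇒Acc-≺ : SN M → Acc _≺_ M
SN⇒Acc-≺ = Acc-∪ (Plus.transitive _◃_) (Plus.wellFounded _◃_ ◃-wellFounded) (StepsLift-⁺ ◃-lift)

-- Bases and contexts as total functions

VarEnv : Set
VarEnv = ℕ → Maybe TyD

NameEnv : Set
NameEnv = ℕ → TyK

variable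
  Γ Γ' Γ₀ Θ Θ₁ Θ₂ : VarEnv
  Δ Δ' Δ₀ : NameEnv
  d e : TyD
  k k₀ K K' : TyK
  φ φ₁ φ₂ φ₃ : Maybe TyD

infixr 5 _∷ᵛ_ _∷ⁿ_
infixl 6 _⊓ᴹ_ _⊓ᵛ_ _⊓ⁿ_
infix 4 _≼ᴹ_ _≼_ _⊑_

_∷ᵛ_ : Maybe TyD → VarEnv → VarEnv
(φ ∷ᵛ Γ) zero    = φ
(φ ∷ᵛ Γ) (suc x) = Γ x

_∷ⁿ_ : TyK → NameEnv → NameEnv
(K ∷ⁿ Δ) zero    = K
(K ∷ⁿ Δ) (suc a) = Δ a

_[_]≔_ : NameEnv → ℕ → TyK → NameEnv
(Δ [ a ]≔ K) b = if b ≡ᵇ a then K else Δ b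

_↦_ : ℕ → TyD → VarEnv
(zero  ↦ d) zero    = just d
(zero  ↦ d) (suc y) = nothing
(suc x ↦ d) zero    = nothing
(suc x ↦ d) (suc y) = (x ↦ d) y

data _≼ᴹ_ : Maybe TyD → Maybe TyD → Set where
  ≼ᴹ-just    : d ≤D e → just d ≼ᴹ just e
  ≼ᴹ-nothing : φ ≼ᴹ nothing

_≼_ : VarEnv → VarEnv → Set
Γ' ≼ Γ = ∀ x → Γ' x ≼ᴹ Γ x

_⊑_ : NameEnv → NameEnv → Set
Δ' ⊑ Δ = ∀ a → Δ' a ≤C Δ a

_⊓ᴹ_ : Maybe TyD → Maybe TyD → Maybe TyD
just d  ⊓ᴹ just e  = just (d ∧D e)
just d  ⊓ᴹ nothing = just d
nothing ⊓ᴹ φ       = φ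

_⊓ᵛ_ : VarEnv → VarEnv → VarEnv
(Γ₁ ⊓ᵛ Γ₂) x = Γ₁ x ⊓ᴹ Γ₂ x

_⊓ⁿ_ : NameEnv → NameEnv → NameEnv
(Δ₁ ⊓ⁿ Δ₂) a = Δ₁ a ∧K Δ₂ a

≼ᴹ-refl : φ ≼ᴹ φ
≼ᴹ-refl {just d}  = ≼ᴹ-just reflD
≼ᴹ-refl {nothing} = ≼ᴹ-nothing

≼ᴹ-trans : φ₁ ≼ᴹ φ₂ → φ₂ ≼ᴹ φ₃ → φ₁ ≼ᴹ φ₃
≼ᴹ-trans (≼ᴹ-just p) (≼ᴹ-just q) = ≼ᴹ-just (transD p q)
≼ᴹ-trans _           ≼ᴹ-nothing  = ≼ᴹ-nothing

≼ᴹ-∧ : φ ≼ᴹ just d → φ ≼ᴹ just e → φ ≼ᴹ just (d ∧D e)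
≼ᴹ-∧ (≼ᴹ-just p) (≼ᴹ-just q) = ≼ᴹ-just (glbD p q)

≼ᴹ-just⁻ : φ ≼ᴹ just e → ∃[ d ] φ ≡ just d × d ≤D e
≼ᴹ-just⁻ (≼ᴹ-just p) = _ , refl , p

just-≼ᴹ-just⁻ : just d ≼ᴹ just e → d ≤D e
just-≼ᴹ-just⁻ (≼ᴹ-just p) = p

fromMaybe-≼ᴹ : ∀ d φ → just (fromMaybe d φ) ≼ᴹ φ
fromMaybe-≼ᴹ d (just e) = ≼ᴹ-just reflD
fromMaybe-≼ᴹ d nothing  = ≼ᴹ-nothing

⊓ᴹ-≼ᴹ⁻ : ∀ φ₁ φ₂ → φ ≼ᴹ φ₁ ⊓ᴹ φ₂ → φ ≼ᴹ φ₁ × φ ≼ᴹ φ₂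
⊓ᴹ-≼ᴹ⁻ (just d) (just e) (≼ᴹ-just p) = ≼ᴹ-just (transD p lb₁D) , ≼ᴹ-just (transD p lb₂D)
⊓ᴹ-≼ᴹ⁻ (just d) nothing  p           = p , ≼ᴹ-nothing
⊓ᴹ-≼ᴹ⁻ nothing  φ₂       p           = ≼ᴹ-nothing , p

All-⊓ᴹ : {P : TyD → Set} → (∀ {d e} → P d → P e → P (d ∧D e)) →
         All P φ₁ → All P φ₂ → All P (φ₁ ⊓ᴹ φ₂)
All-⊓ᴹ _∙_ (just p) (just q) = just (p ∙ q)
All-⊓ᴹ _∙_ (just p) nothing  = just p
All-⊓ᴹ _∙_ nothing  q        = q

≼-refl : Γ ≼ Γ
≼-refl _ = ≼ᴹ-refl

⊑-refl : Δ ⊑ Δ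
⊑-refl _ = reflC

∷-≼ : φ ≼ᴹ Θ zero → Γ ≼ Θ ∘ suc → φ ∷ᵛ Γ ≼ Θ
∷-≼ φ≼ Γ≼ zero    = φ≼
∷-≼ φ≼ Γ≼ (suc x) = Γ≼ x

∷-⊑ : K ≤C Δ zero → Δ' ⊑ Δ ∘ suc → K ∷ⁿ Δ' ⊑ Δ
∷-⊑ K≤ Δ'⊑ zero    = K≤
∷-⊑ K≤ Δ'⊑ (suc a) = Δ'⊑ a

⊓ᵛ-≼ˡ : Θ₁ ⊓ᵛ Θ₂ ≼ Θ₁
⊓ᵛ-≼ˡ {Θ₁} {Θ₂} x = proj₁ (⊓ᴹ-≼ᴹ⁻ (Θ₁ x) (Θ₂ x) ≼ᴹ-refl)

⊓ᵛ-≼ʳ : Θ₁ ⊓ᵛ Θ₂ ≼ Θ₂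
⊓ᵛ-≼ʳ {Θ₁} {Θ₂} x = proj₂ (⊓ᴹ-≼ᴹ⁻ (Θ₁ x) (Θ₂ x) ≼ᴹ-refl)

⊓ⁿ-⊑ˡ : Δ ⊓ⁿ Δ' ⊑ Δ
⊓ⁿ-⊑ˡ _ = lb₁C

⊓ⁿ-⊑ʳ : Δ ⊓ⁿ Δ' ⊑ Δ'
⊓ⁿ-⊑ʳ _ = lb₂C

↦-self : ∀ x → (x ↦ d) x ≼ᴹ just d
↦-self zero    = ≼ᴹ-refl
↦-self (suc x) = ↦-self x

↦-All : {P : ℕ → TyD → Set} → ∀ x → P x d → ∀ y → All (P y) ((x ↦ d) y)
↦-All zero    p zero    = just p
↦-All zero    p (suc y) = nothing
↦-All (suc x) p zero    = nothing
↦-All {P = P} (suc x) p (suc y) = ↦-All {P = P ∘ suc} x p y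

≔-hit : ∀ b a → (b ≡ᵇ a) ≡ true → (Δ [ a ]≔ K) b ≤C K
≔-hit {Δ} {K} b a eq = subst (_≤C K) (sym (cong (λ t → if t then K else Δ b) eq)) reflC

≔-miss : ∀ b a → (b ≡ᵇ a) ≡ false → (Δ [ a ]≔ K) b ≤C Δ b
≔-miss {Δ} {K} b a eq = subst (_≤C Δ b) (sym (cong (λ t → if t then K else Δ b) eq)) reflC

∷-≔ : K ∷ⁿ (Δ [ a ]≔ K') ⊑ (K ∷ⁿ Δ) [ suc a ]≔ K'
∷-≔ = ∷-⊑ reflC (λ _ → reflC)

-- A syntax-directed form of ⊢ʳ: Γ ⊢ M ∶ k ∣ Δ stands for M : k ⇒ψ, subsumption happens only
-- at variables and at the end of commands, and intersections are introduced only for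
-- arguments (⊢ᵈ).

infix 3 _⊢_∶_∣_ _⊢ᵈ_∶_∣_ _⊢ᶜ_∣_

mutual
  data _⊢_∶_∣_ : VarEnv → Term → TyK → NameEnv → Set where
    ⊢var : Γ x ≼ᴹ just (k ⇒ψ) → Γ ⊢ var x ∶ k ∣ Δ
    ⊢lam : just d ∷ᵛ Γ ⊢ M ∶ k ∣ Δ → Γ ⊢ lam M ∶ d ×K k ∣ Δ
    ⊢app : Γ ⊢ M ∶ d ×K k ∣ Δ → Γ ⊢ᵈ N ∶ d ∣ Δ → Γ ⊢ app M N ∶ k ∣ Δ
    ⊢mu  : Γ ⊢ᶜ c ∣ K ∷ⁿ Δ → Γ ⊢ mu c ∶ K ∣ Δ

  data _⊢ᵈ_∶_∣_ (Γ : VarEnv) (N : Term) : TyD → NameEnv → Set where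
    ⊢⇒ψ : Γ ⊢ N ∶ k ∣ Δ → Γ ⊢ᵈ N ∶ k ⇒ψ ∣ Δ
    ⊢∧  : Γ ⊢ᵈ N ∶ d ∣ Δ → Γ ⊢ᵈ N ∶ e ∣ Δ → Γ ⊢ᵈ N ∶ d ∧D e ∣ Δ

  data _⊢ᶜ_∣_ : VarEnv → Cmd → NameEnv → Set where
    ⊢named : Γ ⊢ M ∶ k ∣ Δ → Δ b ≤C k → Γ ⊢ᶜ named b M ∣ Δ

mutual
  ⊢-mono : Γ' ≼ Γ → Δ' ⊑ Δ → Γ ⊢ M ∶ k ∣ Δ → Γ' ⊢ M ∶ k ∣ Δ'
  ⊢-mono Γ'≼Γ Δ'⊑Δ (⊢var {x = x} p) = ⊢var (≼ᴹ-trans (Γ'≼Γ x) p)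
  ⊢-mono Γ'≼Γ Δ'⊑Δ (⊢lam D)   = ⊢lam (⊢-mono (∷-≼ ≼ᴹ-refl Γ'≼Γ) Δ'⊑Δ D)
  ⊢-mono Γ'≼Γ Δ'⊑Δ (⊢app D A) = ⊢app (⊢-mono Γ'≼Γ Δ'⊑Δ D) (⊢ᵈ-mono Γ'≼Γ Δ'⊑Δ A)
  ⊢-mono Γ'≼Γ Δ'⊑Δ (⊢mu C)    = ⊢mu (⊢ᶜ-mono Γ'≼Γ (∷-⊑ reflC Δ'⊑Δ) C)

  ⊢ᵈ-mono : Γ' ≼ Γ → Δ' ⊑ Δ → Γ ⊢ᵈ N ∶ d ∣ Δ → Γ' ⊢ᵈ N ∶ d ∣ Δ'
  ⊢ᵈ-mono Γ'≼Γ Δ'⊑Δ (⊢⇒ψ D)  = ⊢⇒ψ (⊢-mono Γ'≼Γ Δ'⊑Δ D)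
  ⊢ᵈ-mono Γ'≼Γ Δ'⊑Δ (⊢∧ A B) = ⊢∧ (⊢ᵈ-mono Γ'≼Γ Δ'⊑Δ A) (⊢ᵈ-mono Γ'≼Γ Δ'⊑Δ B)

  ⊢ᶜ-mono : Γ' ≼ Γ → Δ' ⊑ Δ → Γ ⊢ᶜ c ∣ Δ → Γ' ⊢ᶜ c ∣ Δ'
  ⊢ᶜ-mono Γ'≼Γ Δ'⊑Δ (⊢named {b = b} D le) = ⊢named (⊢-mono Γ'≼Γ Δ'⊑Δ D) (transC (Δ'⊑Δ b) le)

⊢ᵈ-var⇒≼ᴹ : Γ ⊢ᵈ var x ∶ e ∣ Δ → Γ x ≼ᴹ just e
⊢ᵈ-var⇒≼ᴹ (⊢⇒ψ (⊢var p)) = p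
⊢ᵈ-var⇒≼ᴹ (⊢∧ A B)       = ≼ᴹ-∧ (⊢ᵈ-var⇒≼ᴹ A) (⊢ᵈ-var⇒≼ᴹ B)

All-⊢ᵈ-var⇒≼ᴹ : All (λ e → Γ ⊢ᵈ var x ∶ e ∣ Δ) φ → Γ x ≼ᴹ φ
All-⊢ᵈ-var⇒≼ᴹ (just A) = ⊢ᵈ-var⇒≼ᴹ A
All-⊢ᵈ-var⇒≼ᴹ nothing  = ≼ᴹ-nothing

-- Inversion of renaming and substitution

mutual
  renT-reflects-⊢ : ∀ ρ M → Γ' ≼ Γ ∘ ρ → Γ ⊢ renT ρ M ∶ k ∣ Δ → Γ' ⊢ M ∶ k ∣ Δ
  renT-reflects-⊢ ρ (var i)   h (⊢var p)   = ⊢var (≼ᴹ-trans (h i) p)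
  renT-reflects-⊢ ρ (lam M)   h (⊢lam D)   = ⊢lam (renT-reflects-⊢ (extR ρ) M (∷-≼ ≼ᴹ-refl h) D)
  renT-reflects-⊢ ρ (app M N) h (⊢app D A) =
    ⊢app (renT-reflects-⊢ ρ M h D) (renT-reflects-⊢ᵈ ρ N h A)
  renT-reflects-⊢ ρ (mu (named a M)) h (⊢mu (⊢named D le)) =
    ⊢mu (⊢named (renT-reflects-⊢ ρ M h D) le)

  renT-reflects-⊢ᵈ : ∀ ρ N → Γ' ≼ Γ ∘ ρ → Γ ⊢ᵈ renT ρ N ∶ d ∣ Δ → Γ' ⊢ᵈ N ∶ d ∣ Δ
  renT-reflects-⊢ᵈ ρ N h (⊢⇒ψ D)  = ⊢⇒ψ (renT-reflects-⊢ ρ N h D)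
  renT-reflects-⊢ᵈ ρ N h (⊢∧ A B) = ⊢∧ (renT-reflects-⊢ᵈ ρ N h A) (renT-reflects-⊢ᵈ ρ N h B)

mutual
  renN-reflects-⊢ : ∀ ρ M → Δ' ⊑ Δ ∘ ρ → Γ ⊢ renN ρ M ∶ k ∣ Δ → Γ ⊢ M ∶ k ∣ Δ'
  renN-reflects-⊢ ρ (var i)   h (⊢var p)   = ⊢var p
  renN-reflects-⊢ ρ (lam M)   h (⊢lam D)   = ⊢lam (renN-reflects-⊢ ρ M h D)
  renN-reflects-⊢ ρ (app M N) h (⊢app D A) =
    ⊢app (renN-reflects-⊢ ρ M h D) (renN-reflects-⊢ᵈ ρ N h A)
  renN-reflects-⊢ {Δ'} {Δ} ρ (mu (named a M)) h (⊢mu {K = K} (⊢named D le)) =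
    ⊢mu (⊢named (renN-reflects-⊢ (extR ρ) M h' D) (transC (h' a) le))
    where
      h' : K ∷ⁿ Δ' ⊑ (K ∷ⁿ Δ) ∘ extR ρ
      h' = ∷-⊑ reflC h

  renN-reflects-⊢ᵈ : ∀ ρ N → Δ' ⊑ Δ ∘ ρ → Γ ⊢ᵈ renN ρ N ∶ d ∣ Δ → Γ ⊢ᵈ N ∶ d ∣ Δ'
  renN-reflects-⊢ᵈ ρ N h (⊢⇒ψ D)  = ⊢⇒ψ (renN-reflects-⊢ ρ N h D)
  renN-reflects-⊢ᵈ ρ N h (⊢∧ A B) = ⊢∧ (renN-reflects-⊢ᵈ ρ N h A) (renN-reflects-⊢ᵈ ρ N h B)

_⊢ˢ_∶_∣_ : VarEnv → (ℕ → Term) → VarEnv → NameEnv → Set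
Γ ⊢ˢ σ ∶ Θ ∣ Δ = ∀ x → All (λ e → Γ ⊢ᵈ σ x ∶ e ∣ Δ) (Θ x)

⊢ˢ-⊓ᵛ : ∀ {σ} → Γ ⊢ˢ σ ∶ Θ₁ ∣ Δ → Γ ⊢ˢ σ ∶ Θ₂ ∣ Δ → Γ ⊢ˢ σ ∶ Θ₁ ⊓ᵛ Θ₂ ∣ Δ
⊢ˢ-⊓ᵛ σ∶Θ₁ σ∶Θ₂ x = All-⊓ᴹ ⊢∧ (σ∶Θ₁ x) (σ∶Θ₂ x)

mutual
  subT-reflects-⊢ : ∀ M σ → Γ ⊢ subT σ M ∶ k ∣ Δ → ∃[ Θ ] Θ ⊢ M ∶ k ∣ Δ × Γ ⊢ˢ σ ∶ Θ ∣ Δ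
  subT-reflects-⊢ {Γ} {k} {Δ} (var x) σ D =
    x ↦ (k ⇒ψ) , ⊢var (↦-self x) , ↦-All {P = λ y e → Γ ⊢ᵈ σ y ∶ e ∣ Δ} x (⊢⇒ψ D)
  subT-reflects-⊢ (lam M) σ (⊢lam D) with subT-reflects-⊢ M (extS σ) D
  ... | Θ , DM , σ∶Θ =
    Θ ∘ suc ,
    ⊢lam (⊢-mono (∷-≼ (All-⊢ᵈ-var⇒≼ᴹ (σ∶Θ zero)) ≼-refl) ⊑-refl DM) ,
    λ y → All.map (renT-reflects-⊢ᵈ suc (σ y) ≼-refl) (σ∶Θ (suc y))
  subT-reflects-⊢ (app M N) σ (⊢app D A) with subT-reflects-⊢ M σ D | subT-reflects-⊢ᵈ N σ A
  ... | Θ₁ , D₁ , σ∶Θ₁ | Θ₂ , A₂ , σ∶Θ₂ =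
    Θ₁ ⊓ᵛ Θ₂ , ⊢app (⊢-mono ⊓ᵛ-≼ˡ ⊑-refl D₁) (⊢ᵈ-mono ⊓ᵛ-≼ʳ ⊑-refl A₂) , ⊢ˢ-⊓ᵛ σ∶Θ₁ σ∶Θ₂
  subT-reflects-⊢ (mu (named a M)) σ (⊢mu (⊢named D le)) with subT-reflects-⊢ M (renN suc ∘ σ) D
  ... | Θ , DM , σ∶Θ =
    Θ , ⊢mu (⊢named DM le) , λ x → All.map (renN-reflects-⊢ᵈ suc (σ x) ⊑-refl) (σ∶Θ x)

  subT-reflects-⊢ᵈ : ∀ M σ → Γ ⊢ᵈ subT σ M ∶ d ∣ Δ → ∃[ Θ ] Θ ⊢ᵈ M ∶ d ∣ Δ × Γ ⊢ˢ σ ∶ Θ ∣ Δ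
  subT-reflects-⊢ᵈ M σ (⊢⇒ψ D) with subT-reflects-⊢ M σ D
  ... | Θ , DM , σ∶Θ = Θ , ⊢⇒ψ DM , σ∶Θ
  subT-reflects-⊢ᵈ M σ (⊢∧ A B) with subT-reflects-⊢ᵈ M σ A | subT-reflects-⊢ᵈ M σ B
  ... | Θ₁ , A₁ , σ∶Θ₁ | Θ₂ , B₂ , σ∶Θ₂ =
    Θ₁ ⊓ᵛ Θ₂ , ⊢∧ (⊢ᵈ-mono ⊓ᵛ-≼ˡ ⊑-refl A₁) (⊢ᵈ-mono ⊓ᵛ-≼ʳ ⊑-refl B₂) , ⊢ˢ-⊓ᵛ σ∶Θ₁ σ∶Θ₂

-- Inverting _[a ⇐ L]: φ collects the types at which the appended copies of L are used
-- (nothing if there are none); using a single e ≤ φ instead moves e into the continuation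
-- type of a.
StrInverse : VarEnv → NameEnv → Term → ℕ → (NameEnv → Set) → Set
StrInverse Γ Δ L a J =
  ∃[ φ ] All (λ e → Γ ⊢ᵈ L ∶ e ∣ Δ) φ × (∀ {e} → just e ≼ᴹ φ → J (Δ [ a ]≔ (e ×K Δ a)))

mutual
  strS-reflects-⊢ : ∀ M a L → Γ ⊢ strS a L M ∶ k ∣ Δ → StrInverse Γ Δ L a (Γ ⊢ M ∶ k ∣_)
  strS-reflects-⊢ (var i) a L (⊢var p) = nothing , nothing , λ _ → ⊢var p
  strS-reflects-⊢ (lam M) a L (⊢lam D) with strS-reflects-⊢ M a (renT suc L) D
  ... | φ , L∶φ , DM = φ , All.map (renT-reflects-⊢ᵈ suc L ≼-refl) L∶φ , λ e≼φ → ⊢lam (DM e≼φ)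
  strS-reflects-⊢ (app M N) a L (⊢app D A) with strS-reflects-⊢ M a L D | strS-reflects-⊢ᵈ N a L A
  ... | φ₁ , L∶φ₁ , DM | φ₂ , L∶φ₂ , AN =
    φ₁ ⊓ᴹ φ₂ , All-⊓ᴹ ⊢∧ L∶φ₁ L∶φ₂ ,
    λ e≼φ → let e≼φ₁ , e≼φ₂ = ⊓ᴹ-≼ᴹ⁻ φ₁ φ₂ e≼φ in ⊢app (DM e≼φ₁) (AN e≼φ₂)
  strS-reflects-⊢ (mu c) a L (⊢mu C) with strSC-reflects-⊢ c (suc a) (renN suc L) C
  ... | φ , L∶φ , Cc =
    φ , All.map (renN-reflects-⊢ᵈ suc L ⊑-refl) L∶φ , λ e≼φ → ⊢mu (⊢ᶜ-mono ≼-refl ∷-≔ (Cc e≼φ))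

  strS-reflects-⊢ᵈ : ∀ M a L → Γ ⊢ᵈ strS a L M ∶ d ∣ Δ → StrInverse Γ Δ L a (Γ ⊢ᵈ M ∶ d ∣_)
  strS-reflects-⊢ᵈ M a L (⊢⇒ψ D) with strS-reflects-⊢ M a L D
  ... | φ , L∶φ , DM = φ , L∶φ , λ e≼φ → ⊢⇒ψ (DM e≼φ)
  strS-reflects-⊢ᵈ M a L (⊢∧ A B) with strS-reflects-⊢ᵈ M a L A | strS-reflects-⊢ᵈ M a L B
  ... | φ₁ , L∶φ₁ , AM | φ₂ , L∶φ₂ , BM =
    φ₁ ⊓ᴹ φ₂ , All-⊓ᴹ ⊢∧ L∶φ₁ L∶φ₂ ,
    λ e≼φ → let e≼φ₁ , e≼φ₂ = ⊓ᴹ-≼ᴹ⁻ φ₁ φ₂ e≼φ in ⊢∧ (AM e≼φ₁) (BM e≼φ₂)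

  strSC-reflects-⊢ : ∀ c a L → Γ ⊢ᶜ strSC a L c ∣ Δ → StrInverse Γ Δ L a (Γ ⊢ᶜ c ∣_)
  strSC-reflects-⊢ (named b M) a L C with b ≡ᵇ a in b≟a
  strSC-reflects-⊢ {Δ = Δ} (named b M) a L (⊢named (⊢app {d = d} D A) le) | true
    with ≡ᵇ⇒≡ b a (Equivalence.from T-≡ b≟a) | strS-reflects-⊢ M a L D
  ... | refl | φ , L∶φ , DM =
    φ ⊓ᴹ just d , All-⊓ᴹ ⊢∧ L∶φ (just A) ,
    λ e≼φ⊓d → let e≼φ , e≼d = ⊓ᴹ-≼ᴹ⁻ φ (just d) e≼φ⊓d in
              ⊢named (DM e≼φ) (transC (≔-hit {Δ} a a b≟a) (prodC (just-≼ᴹ-just⁻ e≼d) le))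
  strSC-reflects-⊢ {Δ = Δ} (named b M) a L (⊢named D le) | false with strS-reflects-⊢ M a L D
  ... | φ , L∶φ , DM = φ , L∶φ , λ e≼φ → ⊢named (DM e≼φ) (transC (≔-miss {Δ} b a b≟a) le)

-- Expansion of head redexes

-- The argument D₀ is only used when the contractum has erased the argument.
⊢ᵈ-fromMaybe : All (λ e → Γ ⊢ᵈ N ∶ e ∣ Δ) φ → Γ₀ ⊢ N ∶ k₀ ∣ Δ₀ →
               Γ ⊓ᵛ Γ₀ ⊢ᵈ N ∶ fromMaybe (k₀ ⇒ψ) φ ∣ Δ ⊓ⁿ Δ₀
⊢ᵈ-fromMaybe (just A) D₀ = ⊢ᵈ-mono ⊓ᵛ-≼ˡ ⊓ⁿ-⊑ˡ A
⊢ᵈ-fromMaybe nothing  D₀ = ⊢⇒ψ (⊢-mono ⊓ᵛ-≼ʳ ⊓ⁿ-⊑ʳ D₀)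

β-expansion : ∀ M N → Γ ⊢ subT (sub0 N) M ∶ k ∣ Δ → Γ₀ ⊢ N ∶ k₀ ∣ Δ₀ →
              Γ ⊓ᵛ Γ₀ ⊢ app (lam M) N ∶ k ∣ Δ ⊓ⁿ Δ₀
β-expansion {Γ} {Γ₀ = Γ₀} {k₀ = k₀} M N D D₀ with subT-reflects-⊢ M (sub0 N) D
... | Θ , DM , N∶Θ = ⊢app (⊢lam (⊢-mono Γ⊓Γ₀≼ ⊓ⁿ-⊑ˡ DM)) (⊢ᵈ-fromMaybe (N∶Θ zero) D₀)
  where
    Γ⊓Γ₀≼ : just (fromMaybe (k₀ ⇒ψ) (Θ zero)) ∷ᵛ Γ ⊓ᵛ Γ₀ ≼ Θ
    Γ⊓Γ₀≼ = ∷-≼ (fromMaybe-≼ᴹ (k₀ ⇒ψ) (Θ zero))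
                (λ y → ≼ᴹ-trans (⊓ᵛ-≼ˡ {Γ} {Γ₀} y) (All-⊢ᵈ-var⇒≼ᴹ (N∶Θ (suc y))))

μ-expansion : ∀ c N → Γ ⊢ mu (strSC zero (renN suc N) c) ∶ k ∣ Δ → Γ₀ ⊢ N ∶ k₀ ∣ Δ₀ →
              Γ ⊓ᵛ Γ₀ ⊢ app (mu c) N ∶ k ∣ Δ ⊓ⁿ Δ₀
μ-expansion {k₀ = k₀} c N (⊢mu C) D₀ with strSC-reflects-⊢ c zero (renN suc N) C
... | φ , N∶φ , Cc =
  ⊢app (⊢mu (⊢ᶜ-mono ⊓ᵛ-≼ˡ (∷-⊑ reflC (λ _ → lb₁C)) (Cc (fromMaybe-≼ᴹ (k₀ ⇒ψ) φ))))
       (⊢ᵈ-fromMaybe (All.map (renN-reflects-⊢ᵈ suc N ⊑-refl) N∶φ) D₀)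

record HeadRedex (M : Term) : Set where
  field
    contractum : Term
    argument   : Term
    reduces    : M ⟶ contractum
    argument⊏  : argument ⊏ M
    expand     : ∀ {Γ Δ k Γ₀ Δ₀ k₀} → Γ ⊢ contractum ∶ k ∣ Δ → Γ₀ ⊢ argument ∶ k₀ ∣ Δ₀ →
                 Γ ⊓ᵛ Γ₀ ⊢ M ∶ k ∣ Δ ⊓ⁿ Δ₀

open HeadRedex

headRedex-app : HeadRedex M → HeadRedex (app M N)
headRedex-app {N = N} r = record
  { contractum = app (contractum r) N
  ; argument   = argument r
  ; reduces    = ξappL (reduces r)
  ; argument⊏  = argument⊏ r ∷ʳ app-fun
  ; expand     = λ { (⊢app D A) D₀ → ⊢app (expand r D D₀) (⊢ᵈ-mono ⊓ᵛ-≼ˡ ⊓ⁿ-⊑ˡ A) }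
  }

data Neutral : Term → Set where
  neutral-var : Neutral (var x)
  neutral-app : Neutral M → Neutral (app M N)

appView : ∀ M N → Neutral (app M N) ⊎ HeadRedex (app M N)
appView (var x) N = inj₁ (neutral-app neutral-var)
appView (lam M) N = inj₂ record
  { contractum = subT (sub0 N) M
  ; argument   = N
  ; reduces    = β
  ; argument⊏  = [ app-arg ]
  ; expand     = β-expansion M N
  }
appView (mu c) N = inj₂ record
  { contractum = mu (strSC zero (renN suc N) c)
  ; argument   = N
  ; reduces    = μ
  ; argument⊏  = [ app-arg ]
  ; expand     = μ-expansion c N
  }
appView (app M M') N with appView M M'
... | inj₁ n = inj₁ (neutral-app n)
... | inj₂ r = inj₂ (headRedex-app r)

Typable : Term → Set
Typable M = ∃[ Γ ] ∃[ Δ ] ∃[ k ] Γ ⊢ M ∶ k ∣ Δ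

mutual
  typable : ∀ M → Acc _≺_ M → Typable M
  typable (var x) _ = x ↦ (ω ⇒ψ) , (λ _ → ω) , ω , ⊢var (↦-self x)
  typable (lam M) (acc rs) with typable M (rs (inj₂ [ lam-body ]))
  ... | Γ , Δ , k , D =
    Γ ∘ suc , Δ , fromMaybe (ω ⇒ψ) (Γ zero) ×K k ,
    ⊢lam (⊢-mono (∷-≼ (fromMaybe-≼ᴹ (ω ⇒ψ) (Γ zero)) ≼-refl) ⊑-refl D)
  typable (mu (named a M)) (acc rs) with typable M (rs (inj₂ [ mu-body ]))
  ... | Γ , Δ , k , D =
    Γ , Δₖ ∘ suc , Δₖ zero ,
    ⊢mu (⊢named (⊢-mono ≼-refl (λ b → transC (Δₖ-η b) lb₁C) D) (transC (Δₖ-η a) lb₂C))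
    where
      -- meeting every name with k bounds the continuation type of a by k, whatever a is
      Δₖ : NameEnv
      Δₖ = Δ ⊓ⁿ (λ _ → k)
      Δₖ-η : Δₖ zero ∷ⁿ Δₖ ∘ suc ⊑ Δₖ
      Δₖ-η = ∷-⊑ reflC ⊑-refl
  -- accMN is passed on unopened: re-wrapping acc rs would defeat the termination checker.
  typable (app M N) accMN with appView M N
  ... | inj₁ n with neutral-typable n accMN ω
  ...   | Γ , Δ , D = Γ , Δ , ω , D
  typable (app M N) (acc rs) | inj₂ r
    with typable (contractum r) (rs (inj₁ (reduces r)))
       | typable (argument r) (rs (inj₂ (argument⊏ r)))
  ... | Γ , Δ , k , D | Γ₀ , Δ₀ , k₀ , D₀ = Γ ⊓ᵛ Γ₀ , Δ ⊓ⁿ Δ₀ , k , expand r D D₀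

  neutral-typable : Neutral M → Acc _≺_ M → ∀ k → ∃[ Γ ] ∃[ Δ ] Γ ⊢ M ∶ k ∣ Δ
  neutral-typable (neutral-var {x}) _ k = x ↦ (k ⇒ψ) , (λ _ → ω) , ⊢var (↦-self x)
  neutral-typable (neutral-app {N = N} n) (acc rs) k with typable N (rs (inj₂ [ app-arg ]))
  ... | Γ₂ , Δ₂ , k₂ , D₂ with neutral-typable n (rs (inj₂ [ app-fun ])) ((k₂ ⇒ψ) ×K k)
  ... | Γ₁ , Δ₁ , D₁ =
    Γ₁ ⊓ᵛ Γ₂ , Δ₁ ⊓ⁿ Δ₂ , ⊢app (⊢-mono ⊓ᵛ-≼ˡ ⊓ⁿ-⊑ˡ D₁) (⊢⇒ψ (⊢-mono ⊓ᵛ-≼ʳ ⊓ⁿ-⊑ʳ D₂))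

-- Reading derivations back into ⊢ʳ

-- ⊢ʳ uses finite lists, so the total environments are truncated beyond the free variables
-- and names of the term.

mutual
  data Scoped : ℕ → ℕ → Term → Set where
    sc-var : x < n → Scoped n m (var x)
    sc-lam : Scoped (suc n) m M → Scoped n m (lam M)
    sc-app : Scoped n m M → Scoped n m N → Scoped n m (app M N)
    sc-mu  : ScopedCmd n (suc m) c → Scoped n m (mu c)

  data ScopedCmd : ℕ → ℕ → Cmd → Set where
    sc-named : a < m → Scoped n m M → ScopedCmd n m (named a M)

Scoped-mono : n ≤ n' → m ≤ m' → Scoped n m M → Scoped n' m' M
Scoped-mono n≤n' m≤m' (sc-var x<n)  = sc-var (≤-trans x<n n≤n')
Scoped-mono n≤n' m≤m' (sc-lam S)    = sc-lam (Scoped-mono (s≤s n≤n') m≤m' S)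
Scoped-mono n≤n' m≤m' (sc-app S S') = sc-app (Scoped-mono n≤n' m≤m' S) (Scoped-mono n≤n' m≤m' S')
Scoped-mono n≤n' m≤m' (sc-mu (sc-named a<m S)) =
  sc-mu (sc-named (≤-trans a<m (s≤s m≤m')) (Scoped-mono n≤n' (s≤s m≤m') S))

scoped : ∀ M → ∃[ n ] ∃[ m ] Scoped n m M
scoped (var x) = suc x , zero , sc-var ≤-refl
scoped (lam M) with scoped M
... | n , m , S = n , m , sc-lam (Scoped-mono (n≤1+n n) ≤-refl S)
scoped (app M N) with scoped M | scoped N
... | n₁ , m₁ , S₁ | n₂ , m₂ , S₂ =
  n₁ ⊔ n₂ , m₁ ⊔ m₂ ,
  sc-app (Scoped-mono (m≤m⊔n n₁ n₂) (m≤m⊔n m₁ m₂) S₁) (Scoped-mono (m≤n⊔m n₁ n₂) (m≤n⊔m m₁ m₂) S₂)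
scoped (mu (named a M)) with scoped M
... | n , m , S =
  n , m ⊔ a ,
  sc-mu (sc-named (s≤s (m≤n⊔m m a)) (Scoped-mono ≤-refl (≤-trans (m≤m⊔n m a) (n≤1+n _)) S))

toBasis : VarEnv → ℕ → Basis
toBasis Γ zero    = []
toBasis Γ (suc n) = Γ zero ∷ toBasis (Γ ∘ suc) n

toCtx : NameEnv → ℕ → Ctx
toCtx Δ zero    = []
toCtx Δ (suc m) = Δ zero ∷ toCtx (Δ ∘ suc) m

lookupΓ-toBasis : ∀ Γ → x < n → lookupΓ (toBasis Γ n) x ≡ Γ x
lookupΓ-toBasis {zero}  Γ (s≤s _)   = refl
lookupΓ-toBasis {suc x} Γ (s≤s x<n) = lookupΓ-toBasis (Γ ∘ suc) x<n

lookupΔ-toCtx : ∀ Δ → a < m → lookupΔ (toCtx Δ m) a ≡ Δ a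
lookupΔ-toCtx {zero}  Δ (s≤s _)   = refl
lookupΔ-toCtx {suc a} Δ (s≤s a<m) = lookupΔ-toCtx (Δ ∘ suc) a<m

mutual
  ⊢-sound : Γ ⊢ M ∶ k ∣ Δ → Scoped n m M → toBasis Γ n ⊢ʳ M ∶ (k ⇒ψ) ∣ toCtx Δ m
  ⊢-sound {Γ} (⊢var p) (sc-var x<n) with ≼ᴹ-just⁻ p
  ... | d , Γx≡d , d≤ = ≤R (ax (trans (lookupΓ-toBasis Γ x<n) Γx≡d)) d≤
  ⊢-sound (⊢lam D)   (sc-lam S)    = lamR (⊢-sound D S)
  ⊢-sound (⊢app D A) (sc-app S S') = appR (⊢-sound D S) (⊢ᵈ-sound A S')
  ⊢-sound (⊢mu C)    (sc-mu S)     = muR (proj₂ (⊢ᶜ-sound C S))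

  ⊢ᵈ-sound : Γ ⊢ᵈ N ∶ d ∣ Δ → Scoped n m N → toBasis Γ n ⊢ʳ N ∶ d ∣ toCtx Δ m
  ⊢ᵈ-sound (⊢⇒ψ D)  S = ⊢-sound D S
  ⊢ᵈ-sound (⊢∧ A B) S = ∧R (⊢ᵈ-sound A S) (⊢ᵈ-sound B S)

  ⊢ᶜ-sound : Γ ⊢ᶜ c ∣ Δ → ScopedCmd n m c →
             ∃[ K ] toBasis Γ n ⊢ᶜʳ c ∶ ((K ⇒ψ) ×K K) ∣ toCtx Δ m
  ⊢ᶜ-sound {Δ = Δ} (⊢named {b = b} D le) (sc-named b<m S) =
    Δ b , ≤Rᶜ (cmdR (⊢-sound D S))
              (prodC (arrD le) (subst (_≤C Δ b) (sym (lookupΔ-toCtx Δ b<m)) reflC))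

theorem6p21 : (M : Term) → SN M →
    ∃[ Γ ] ∃[ Δ ] ∃[ d ] (Γ ⊢ʳ M ∶ d ∣ Δ)
theorem6p21 M sn with typable M (SN⇒Acc-≺ sn) | scoped M
... | Γ , Δ , k , D | n , m , S = toBasis Γ n , toCtx Δ m , k ⇒ψ , ⊢-sound D S
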